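{- Let $\mathcal{B}$ be a building set and let $\mathcal{B}_1,\dots,\mathcal{B}_k$ be its connected components. Then $$\mathcal{N}(\mathcal{B})\simeq\mathcal{N}(\mathcal{B}_1)*\cdots*\mathcal{N}(\mathcal{B}_k)\quad\text{and}\quad\mathcal{N}^{\square}(\mathcal{B})\simeq\mathcal{N}^{\square}(\mathcal{B}_1)*\cdots*\mathcal{N}^{\square}(\mathcal{B}_k).$$
   Context: A building set on a finite set $X$ is a collection $\mathcal{B}$ of nonempty subsets of $X$ containing all singletons and such that $I\cup J\in\mathcal{B}$ whenever $I,J\in\mathcal{B}$, $I\cap J\neq\varnothing$; $\mathcal{B}_{\max}$ is its set of inclusion-maximal elements, and its connected components are the building sets $\mathcal{B}|_M=\{J\in\mathcal{B}:J\subseteq M\}$ on $M$, for $M\in\mathcal{B}_{\max}$. A nested collection is a subset $N\subseteq\mathcal{B}\setminus\mathcal{B}_{\max}$ whose members are pairwise nested or disjoint and such that no union of $k\ge2$ pairwise disjoint members lies in $\mathcal{B}$; $\mathcal{N}(\mathcal{B})$ is the simplicial complex on vertex set $\mathcal{B}\setminus\mathcal{B}_{\max}$ with these faces. An extended nested collection is a set $\{I_1,\dots,I_m,x_{i_1},\dots,x_{i_r}\}$ with $I_j\in\mathcal{B}$ (maximal allowed) and formal symbols $x_i$ ($i\in X$) such that the $I_j$ are pairwise nested or disjoint, no union of $k\ge2$ pairwise disjoint $I_j$'s lies in $\mathcal{B}$, and no $i_\ell$ lies in any $I_j$; $\mathcal{N}^{\square}(\mathcal{B})$ is the simplicial complex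 on vertex set $\mathcal{B}\cup\{x_i:i\in X\}$ with these faces. The join $\Delta*\Delta'$ has vertex set the disjoint union of vertex sets and faces $F\sqcup F'$ with $F\in\Delta,F'\in\Delta'$; $\simeq$ is isomorphism of simplicial complexes. -}

module Defs where

open import Data.Nat using (ℕ; zero; suc; _≤_)
open import Data.Bool using (Bool; true; false; _∧_; not; T)
open import Data.Fin using (Fin)
open import Data.Fin.Subset as S using (Subset; _∈_; _⊆_; _∩_; _∪_; ⋃; ⁅_⁆; Nonempty; Empty; inside; outside)
open import Data.Fin.Subset.Properties using (_⊆?_; _⊂?_)
open import Data.List using (List; []; _∷_; map; length; _++_)
open import Data.Bool.ListAction using (all)
open import Data.List.Relation.Unary.All using (All)
open import Data.List.Relation.Unary.AllPairs using (AllPairs)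
open import Data.Product using (Σ; _×_; _,_; proj₁)
open import Data.Sum using (_⊎_; inj₁; inj₂; [_,_])
open import Data.Unit using () renaming (⊤ to Unit)
open import Data.Empty using () renaming (⊥ to Void)
open import Data.Vec using (_∷_; [])
open import Function using (_∘_; _⇔_; _↔_; Inverse)
open import Relation.Nullary.Decidable using (⌊_⌋)

-- Finite ground sets are subsets of Fin n; subsets are Data.Fin.Subset.
-- A family of subsets (e.g. a building set) is given by its decidable
-- characteristic function  Subset n → Bool.

allSubsets : (n : ℕ) → List (Subset n)
allSubsets zero = [] ∷ []
allSubsets (suc n) = map (outside ∷_) (allSubsets n) ++ map (inside ∷_) (allSubsets n)

Disjoint : {n : ℕ} → Subset n → Subset n → Set
Disjoint I J = Empty (I ∩ J)

record IsBuildingSet {n : ℕ} (G : Subset n) (B : Subset n → Bool) : Set where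
  field
    nonempty   : ∀ I → T (B I) → Nonempty I
    subGround  : ∀ I → T (B I) → I ⊆ G
    singletons : ∀ i → i ∈ G → T (B ⁅ i ⁆)
    unionClosed : ∀ I J → T (B I) → T (B J) → Nonempty (I ∩ J) → T (B (I ∪ J))

isMax : {n : ℕ} → (Subset n → Bool) → Subset n → Bool
isMax {n} B I = B I ∧ all (λ J → not (B J ∧ ⌊ I ⊂? J ⌋)) (allSubsets n)

-- connected component B|_M = {J ∈ B : J ⊆ M}  (a building set on ground set M)
restrict : {n : ℕ} → (Subset n → Bool) → Subset n → (Subset n → Bool)
restrict B M J = B J ∧ ⌊ J ⊆? M ⌋

-- Simplicial complexes: a vertex type together with a predicate on
-- (finite, since vertex types are finite here) sets of vertices,
-- given by characteristic functions V → Bool.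

record SimplicialComplex : Set₁ where
  field
    V    : Set
    Face : (V → Bool) → Set

open SimplicialComplex public

record _≅_ (K L : SimplicialComplex) : Set where
  field
    vmap    : V K ↔ V L
    faceIff : ∀ (F : V L → Bool) → Face K (F ∘ Inverse.to vmap) ⇔ Face L F

_⋆_ : SimplicialComplex → SimplicialComplex → SimplicialComplex
K ⋆ L = record { V = V K ⊎ V L ; Face = λ F → Face K (F ∘ inj₁) × Face L (F ∘ inj₂) }

-- the complex {∅} on no vertices (unit for the join)
unitComplex : SimplicialComplex
unitComplex = record { V = Void ; Face = λ _ → Unit }

joinAll : List SimplicialComplex → SimplicialComplex
joinAll [] = unitComplex
joinAll (K ∷ Ks) = K ⋆ joinAll Ks

-- The nested-collection conditions for the members (selected by F) of a
-- family of vertices labelled by subsets via `sub`: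
-- pairwise nested or disjoint, and no union of k ≥ 2 pairwise disjoint
-- members lies in B.
NestedConds : {n : ℕ} → (Subset n → Bool) → (W : Set) → (W → Subset n) → (W → Bool) → Set
NestedConds B W sub F =
  (∀ u v → T (F u) → T (F v) → (sub u ⊆ sub v) ⊎ (sub v ⊆ sub u) ⊎ Disjoint (sub u) (sub v))
  × (∀ (us : List W) → All (T ∘ F) us → AllPairs (λ u v → Disjoint (sub u) (sub v)) us
       → 2 ≤ length us → B (⋃ (map sub us)) ≡ false)
  where open import Relation.Binary.PropositionalEquality using (_≡_)

-- nested complex N(B) of a building set B on ground set G:
-- vertex set B ∖ B_max
nestedComplex : {n : ℕ} → Subset n → (Subset n → Bool) → SimplicialComplex
nestedComplex {n} G B = record
  { V = Σ (Subset n) (λ I → T (B I ∧ not (isMax B I)))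
  ; Face = λ F → NestedConds B _ proj₁ F }

-- extended nested complex N^□(B): vertex set B ⊔ {x_i : i ∈ G}
extNestedComplex : {n : ℕ} → Subset n → (Subset n → Bool) → SimplicialComplex
extNestedComplex {n} G B = record
  { V = Σ (Subset n) (λ I → T (B I)) ⊎ Σ (Fin n) (λ i → T (Data.Vec.lookup G i))
  ; Face = λ F → NestedConds B _ proj₁ (F ∘ inj₁)
               × (∀ I x → T (F (inj₁ I)) → T (F (inj₂ x)) → ¬ (proj₁ x ∈ proj₁ I)) }
  where open import Relation.Nullary using (¬_)
        import Data.Vec

-- A set of B meeting a maximal element M of B lies inside M (their union is
-- in B), so distinct maximal elements are disjoint and every member of B lies
-- in exactly one component B|_M, where it is maximal iff it is maximal in B.
-- Hence the vertices of N(B) and N□(B) split as disjoint unions over the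
-- components.  The face conditions split as well: sets from different
-- components are disjoint, and a union of pairwise disjoint members taken from
-- two components cannot lie in B, since it would meet one maximal element and
-- hence lie inside it, while containing a nonempty set outside it.
module Submission where

open import Defs
open import Data.Nat using (ℕ; suc; _≤_)
open import Data.Bool using (Bool; T; true; false; _∧_; _∨_; not)
open import Data.Bool.Properties using (T-∧; T-≡; T-irrelevant; ∧-identityʳ)
open import Data.Bool.ListAction using (any)
open import Data.Empty using (⊥; ⊥-elim)
open import Data.Fin using (Fin)
open import Data.Fin.Subset
  using (Subset; _⊆_; _⊂_; _∩_; _∪_; ⋃; ⊤; Nonempty; inside; outside)
  renaming (_∈_ to _∈ₛ_; _∉_ to _∉ₛ_; ⊥ to ∅)
open import Data.Fin.Subset.Properties
  using (_⊆?_; _⊂?_; _∈?_; ⊆-antisym; ∉⊥; ∈⊤; x∈⁅x⁆; p⊆p∪q; q⊆p∪q; x∈p∪q⁻; x∈p∩q⁺; x∈p∩q⁻)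
open import Data.List using (List; []; _∷_; map; length; foldr; filter)
open import Data.List.Properties using (map-∘; map-cong; length-map)
open import Data.List.Membership.Propositional using (_∈_; find; lose)
open import Data.List.Membership.Propositional.Properties
  using (∈-map⁺; ∈-++⁺ˡ; ∈-++⁺ʳ; ∈-filter⁺)
open import Data.List.Relation.Unary.All as All using (All; []; _∷_)
import Data.List.Relation.Unary.All.Properties as AllP
open import Data.List.Relation.Unary.AllPairs as AllPairs using (AllPairs; []; _∷_)
import Data.List.Relation.Unary.AllPairs.Properties as AllPairsP
open import Data.List.Relation.Unary.Any using (here; there)
open import Data.List.Relation.Unary.Any.Properties using (any⁺; any⁻)
open import Data.List.Relation.Unary.Unique.Propositional using (Unique)
open import Data.Product using (Σ; ∃; _×_; _,_; proj₁; proj₂; swap)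
open import Data.Product.Function.Dependent.Propositional using (Σ-↔)
open import Data.Product.Function.NonDependent.Propositional using (_×-⇔_)
open import Data.Sum as Sum using (_⊎_; inj₁; inj₂; [_,_])
open import Data.Sum.Function.Propositional using (_⊎-↔_)
open import Data.Unit using (tt)
open import Data.Vec using (lookup; []; _∷_)
open import Data.Vec.Properties using ([]=⇒lookup; lookup⇒[]=)
open import Function using (_⇔_; _↔_; Inverse; Equivalence; _∘_; id; mk⇔; mk↔ₛ′)
open import Function.Construct.Composition using (_↔-∘_; _⇔-∘_)
open import Function.Construct.Identity using (↔-id; ⇔-id)
open import Function.Related.TypeIsomorphisms using (Σ-distribˡ-⊎)
open import Relation.Nullary using (¬_; yes; no)
open import Relation.Nullary.Decidable using (⌊_⌋; toWitness; fromWitness; T?; _×-dec_)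
open import Relation.Unary using (Decidable)
open import Relation.Binary.PropositionalEquality
  using (_≡_; _≢_; refl; sym; trans; cong; subst; subst₂)

open Equivalence

T-not : ∀ {b} → T (not b) ⇔ (¬ T b)
T-not {true}  = mk⇔ (λ ()) (λ ¬t → ¬t tt)
T-not {false} = mk⇔ (λ _ ()) (λ _ → tt)

T-not-cong : ∀ {a b} → T a ⇔ T b → T (not a) ⇔ T (not b)
T-not-cong a⇔b = mk⇔ (λ t → from T-not (to T-not t ∘ from a⇔b))
                     (λ t → from T-not (to T-not t ∘ to a⇔b))

¬T⇒≡false : ∀ {b} → ¬ T b → b ≡ false
¬T⇒≡false {true}  ¬t = ⊥-elim (¬t tt)
¬T⇒≡false {false} _  = refl

T-⇔⇒↔ : ∀ {a b} → T a ⇔ T b → T a ↔ T b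
T-⇔⇒↔ a⇔b = mk↔ₛ′ (to a⇔b) (from a⇔b) (λ _ → T-irrelevant _ _) (λ _ → T-irrelevant _ _)

T-∨-↔ : ∀ {a b} → (T a → T b → ⊥) → T (a ∨ b) ↔ (T a ⊎ T b)
T-∨-↔ {true}  excl = mk↔ₛ′ (λ _ → inj₁ tt) (λ _ → tt)
  (λ { (inj₁ _) → refl ; (inj₂ q) → ⊥-elim (excl tt q) }) (λ _ → refl)
T-∨-↔ {false} _    = mk↔ₛ′ inj₂ [ (λ ()) , id ] (λ { (inj₁ ()) ; (inj₂ _) → refl }) (λ _ → refl)

Σ-T-↔ : ∀ {A : Set} {P Q : A → Bool} → (∀ a → T (P a) ⇔ T (Q a)) → Σ A (T ∘ P) ↔ Σ A (T ∘ Q)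
Σ-T-↔ {A} P⇔Q = Σ-↔ (↔-id A) (λ {a} → T-⇔⇒↔ (P⇔Q a))

Σ-T-∨-↔ : ∀ {A : Set} {P Q : A → Bool} → (∀ a → T (P a) → T (Q a) → ⊥) →
          Σ A (λ a → T (P a ∨ Q a)) ↔ (Σ A (T ∘ P) ⊎ Σ A (T ∘ Q))
Σ-T-∨-↔ {A} excl = Σ-distribˡ-⊎ ↔-∘ Σ-↔ (↔-id A) (λ {a} → T-∨-↔ (excl a))

module _ {n : ℕ} where

  T-lookup⇔∈ : ∀ (p : Subset n) x → T (lookup p x) ⇔ x ∈ₛ p
  T-lookup⇔∈ p x = mk⇔ (λ t → lookup⇒[]= x p (to T-≡ t)) (λ x∈p → from T-≡ ([]=⇒lookup x∈p))

  Disjoint⇒∉ : ∀ {X Y : Subset n} {x} → Disjoint X Y → x ∈ₛ X → x ∉ₛ Y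
  Disjoint⇒∉ X∩Y≡∅ x∈X x∈Y = X∩Y≡∅ (_ , x∈p∩q⁺ (x∈X , x∈Y))

  Disjoint-sym : ∀ {X Y : Subset n} → Disjoint X Y → Disjoint Y X
  Disjoint-sym {X} {Y} X∩Y≡∅ (x , x∈Y∩X) =
    let x∈Y , x∈X = x∈p∩q⁻ Y X x∈Y∩X in Disjoint⇒∉ X∩Y≡∅ x∈X x∈Y

  Disjoint-⊆ˡ : ∀ {X X' Y : Subset n} → X ⊆ X' → Disjoint X' Y → Disjoint X Y
  Disjoint-⊆ˡ {X} {_} {Y} X⊆X' X'∩Y≡∅ (x , x∈X∩Y) =
    let x∈X , x∈Y = x∈p∩q⁻ X Y x∈X∩Y in Disjoint⇒∉ X'∩Y≡∅ (X⊆X' x∈X) x∈Y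

  ⊆-foldr-∪ : ∀ (I : Subset n) Js → I ⊆ foldr _∪_ I Js
  ⊆-foldr-∪ I []       x∈I = x∈I
  ⊆-foldr-∪ I (J ∷ Js) x∈I = q⊆p∪q J _ (⊆-foldr-∪ I Js x∈I)

  ∈⇒⊆-foldr-∪ : ∀ (I : Subset n) {J Js} → J ∈ Js → J ⊆ foldr _∪_ I Js
  ∈⇒⊆-foldr-∪ I {Js = _ ∷ Js} (here refl) x∈J = p⊆p∪q (foldr _∪_ I Js) x∈J
  ∈⇒⊆-foldr-∪ I {Js = J ∷ _}  (there J∈)  x∈J = q⊆p∪q J _ (∈⇒⊆-foldr-∪ I J∈ x∈J)

  module _ {W : Set} (s : W → Subset n) where

    ⋃-map-⊆ : ∀ {M} → (∀ w → s w ⊆ M) → ∀ ws → ⋃ (map s ws) ⊆ M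
    ⋃-map-⊆ s⊆M []       x∈∅ = ⊥-elim (∉⊥ x∈∅)
    ⋃-map-⊆ s⊆M (w ∷ ws) x∈⋃ = [ s⊆M w , ⋃-map-⊆ s⊆M ws ] (x∈p∪q⁻ (s w) _ x∈⋃)

    ∈⇒⊆-⋃-map : ∀ {w ws} → w ∈ ws → s w ⊆ ⋃ (map s ws)
    ∈⇒⊆-⋃-map w∈ws = ∈⇒⊆-foldr-∪ ∅ (∈-map⁺ s w∈ws)

∈-allSubsets : ∀ {n} (J : Subset n) → J ∈ allSubsets n
∈-allSubsets []            = here refl
∈-allSubsets (outside ∷ J) = ∈-++⁺ˡ (∈-map⁺ (outside ∷_) (∈-allSubsets J))
∈-allSubsets {suc n} (inside ∷ J) =
  ∈-++⁺ʳ (map (outside ∷_) (allSubsets n)) (∈-map⁺ (inside ∷_) (∈-allSubsets J))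

-- Maximal elements and components

module _ {n : ℕ} (B : Subset n → Bool) where

  T-restrict : ∀ {M I} → T (restrict B M I) ⇔ (T (B I) × I ⊆ M)
  T-restrict {M} {I} = mk⇔
    (λ t → let bI , I⊆M = to (T-∧ {B I}) t in bI , toWitness I⊆M)
    (λ (bI , I⊆M) → from T-∧ (bI , fromWitness I⊆M))

  restrict-⊆ : ∀ {M U} → U ⊆ M → restrict B M U ≡ B U
  restrict-⊆ {M} {U} U⊆M =
    trans (cong (B U ∧_) (to T-≡ (fromWitness {a? = U ⊆? M} U⊆M))) (∧-identityʳ (B U))

  T-isMax : ∀ {I} → T (isMax B I) ⇔ (T (B I) × (∀ J → T (B J) → ¬ I ⊂ J))
  T-isMax {I} = mk⇔ sound complete
    where
    noLarger : Subset n → Bool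
    noLarger J = not (B J ∧ ⌊ I ⊂? J ⌋)

    T-noLarger : ∀ J → T (noLarger J) ⇔ (T (B J) → ¬ I ⊂ J)
    T-noLarger J = mk⇔
      (λ t bJ I⊂J → to T-not t (from T-∧ (bJ , fromWitness I⊂J)))
      (λ h → from T-not (λ t → let bJ , I⊂J = to (T-∧ {B J}) t in h bJ (toWitness I⊂J)))

    sound : T (isMax B I) → T (B I) × (∀ J → T (B J) → ¬ I ⊂ J)
    sound t = let bI , none = to (T-∧ {B I}) t in
      bI , λ J → to (T-noLarger J) (All.lookup (AllP.all⁺ noLarger _ none) (∈-allSubsets J))

    complete : T (B I) × (∀ J → T (B J) → ¬ I ⊂ J) → T (isMax B I)
    complete (bI , none) =
      from T-∧ (bI , AllP.all⁻ noLarger {allSubsets n}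
                       (All.tabulate λ {J} _ → from (T-noLarger J) (none J)))

  isMax⇒B : ∀ {M} → T (isMax B M) → T (B M)
  isMax⇒B = proj₁ ∘ to T-isMax

module _ {n : ℕ} {B : Subset n → Bool} (bs : IsBuildingSet ⊤ B) where
  open IsBuildingSet bs

  -- Otherwise J ∪ M would be a member of B strictly containing M.
  isMax-absorbs : ∀ {M J} → T (isMax B M) → T (B J) → Nonempty (J ∩ M) → J ⊆ M
  isMax-absorbs {M} {J} mM bJ J∩M≢∅ {x} x∈J with x ∈? M
  ... | yes x∈M = x∈M
  ... | no  x∉M = ⊥-elim (proj₂ (to (T-isMax B) mM) (J ∪ M)
          (unionClosed J M bJ (isMax⇒B B mM) J∩M≢∅)
          (q⊆p∪q J M , x , p⊆p∪q M x∈J , x∉M))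

  isMax-disjoint : ∀ {M M'} → T (isMax B M) → T (isMax B M') → M ≢ M' → Disjoint M M'
  isMax-disjoint {M} {M'} mM mM' M≢M' (x , x∈M∩M') = M≢M' (⊆-antisym
    (isMax-absorbs mM' (isMax⇒B B mM) (x , x∈M∩M'))
    (isMax-absorbs mM (isMax⇒B B mM') (x , x∈p∩q⁺ (swap (x∈p∩q⁻ M M' x∈M∩M')))))

  foldr-∪-closed : ∀ {I} → T (B I) → ∀ Js → All (λ J → T (B J) × I ⊆ J) Js → T (B (foldr _∪_ I Js))
  foldr-∪-closed bI []       []                  = bI
  foldr-∪-closed {I} bI (J ∷ Js) ((bJ , I⊆J) ∷ above) = let x , x∈I = nonempty I bI in
    unionClosed J _ bJ (foldr-∪-closed bI Js above) (x , x∈p∩q⁺ (I⊆J x∈I , ⊆-foldr-∪ I Js x∈I))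

  -- The union of all members of B containing I is in B, hence maximal.
  isMax-above : ∀ {I} → T (B I) → ∃ λ M → T (isMax B M) × I ⊆ M
  isMax-above {I} bI =
    U , from (T-isMax B) (foldr-∪-closed bI Js (AllP.all-filter above? (allSubsets n)) , maximal) ,
    ⊆-foldr-∪ I Js
    where
    above? : Decidable (λ J → T (B J) × I ⊆ J)
    above? J = T? (B J) ×-dec I ⊆? J

    Js : List (Subset n)
    Js = filter above? (allSubsets n)

    U : Subset n
    U = foldr _∪_ I Js

    maximal : ∀ J → T (B J) → ¬ U ⊂ J
    maximal J bJ (U⊆J , x , x∈J , x∉U) =
      x∉U (∈⇒⊆-foldr-∪ I (∈-filter⁺ above? (∈-allSubsets J) (bJ , U⊆J ∘ ⊆-foldr-∪ I Js)) x∈J)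

  -- A member of B strictly containing I ⊆ M meets M, so it lies in M.
  isMax-restrict : ∀ {M I} → T (isMax B M) → I ⊆ M → T (isMax B I) ⇔ T (isMax (restrict B M) I)
  isMax-restrict {M} {I} mM I⊆M = mk⇔ maxInB⇒maxInM maxInM⇒maxInB
    where
    maxInB⇒maxInM : T (isMax B I) → T (isMax (restrict B M) I)
    maxInB⇒maxInM mI = let bI , none = to (T-isMax B) mI in
      from (T-isMax (restrict B M)) (from (T-restrict B) (bI , I⊆M) ,
                                     λ J rJ → none J (proj₁ (to (T-restrict B) rJ)))

    maxInM⇒maxInB : T (isMax (restrict B M) I) → T (isMax B I)
    maxInM⇒maxInB mI =
      let rI , none = to (T-isMax (restrict B M)) mI
          bI , _ = to (T-restrict B) rI
          x , x∈I = nonempty I bI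
          J⊆M : ∀ {J} → T (B J) → I ⊂ J → J ⊆ M
          J⊆M bJ I⊂J = isMax-absorbs mM bJ (x , x∈p∩q⁺ (proj₁ I⊂J x∈I , I⊆M x∈I))
      in from (T-isMax B) (bI , λ J bJ I⊂J → none J (from (T-restrict B) (bJ , J⊆M bJ I⊂J)) I⊂J)

-- Nested conditions on labelled families of subsets

NestedOrDisjoint : ∀ {n} → Subset n → Subset n → Set
NestedOrDisjoint X Y = (X ⊆ Y) ⊎ (Y ⊆ X) ⊎ Disjoint X Y

module _ {n : ℕ} (B : Subset n → Bool) {W W' : Set} {s : W → Subset n} {s' : W' → Subset n}
         {G : W → Bool} {G' : W' → Bool} (f : W → W')
         (label : ∀ w → s' (f w) ≡ s w) (select : ∀ w → G' (f w) ≡ G w) where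

  NestedConds-pullback : NestedConds B W' s' G' → NestedConds B W s G
  NestedConds-pullback (nested , unions) = nested′ , unions′
    where
    selected : ∀ {w} → T (G w) → T (G' (f w))
    selected {w} = subst T (sym (select w))

    nested′ : ∀ u v → T (G u) → T (G v) → NestedOrDisjoint (s u) (s v)
    nested′ u v gu gv =
      subst₂ NestedOrDisjoint (label u) (label v) (nested (f u) (f v) (selected gu) (selected gv))

    unions′ : ∀ us → All (T ∘ G) us → AllPairs (λ u v → Disjoint (s u) (s v)) us →
              2 ≤ length us → B (⋃ (map s us)) ≡ false
    unions′ us sel disj len = subst (λ X → B (⋃ X) ≡ false) labels (unions (map f us)
      (AllP.map⁺ (All.map selected sel))
      (AllPairsP.map⁺ (AllPairs.map (subst₂ Disjoint (sym (label _)) (sym (label _))) disj))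
      (subst (2 ≤_) (sym (length-map f us)) len))
      where
      labels : map s' (map f us) ≡ map s us
      labels = trans (sym (map-∘ us)) (map-cong label us)

NestedConds-↔ : ∀ {n} (B : Subset n → Bool) {W W' : Set} {s : W → Subset n} {s' : W' → Subset n}
  (e : W ↔ W') → (∀ w' → s (Inverse.from e w') ≡ s' w') →
  ∀ F → NestedConds B W s (F ∘ Inverse.to e) ⇔ NestedConds B W' s' F
NestedConds-↔ B {s = s} e label F = mk⇔
  (NestedConds-pullback B (Inverse.from e) label (λ w' → cong F (Inverse.strictlyInverseˡ e w')))
  (NestedConds-pullback B (Inverse.to e)
     (λ w → trans (sym (label (Inverse.to e w))) (cong s (Inverse.strictlyInverseʳ e w)))
     (λ _ → refl))

NestedConds-restrict : ∀ {n} (B : Subset n → Bool) M {W : Set} (s : W → Subset n) →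
  (∀ w → s w ⊆ M) → ∀ F → NestedConds B W s F ⇔ NestedConds (restrict B M) W s F
NestedConds-restrict B M s s⊆M F = mk⇔
  (λ (nested , unions) → nested , λ us sel disj len → trans (agree us) (unions us sel disj len))
  (λ (nested , unions) → nested , λ us sel disj len → trans (sym (agree us)) (unions us sel disj len))
  where
  agree : ∀ us → restrict B M (⋃ (map s us)) ≡ B (⋃ (map s us))
  agree us = restrict-⊆ B (⋃-map-⊆ s s⊆M us)

data SumListView {A B : Set} : List (A ⊎ B) → Set where
  lefts  : ∀ as → SumListView (map inj₁ as)
  rights : ∀ bs → SumListView (map inj₂ bs)
  mixed  : ∀ {xs a b} → inj₁ a ∈ xs → inj₂ b ∈ xs → SumListView xs

sumListView : ∀ {A B : Set} (xs : List (A ⊎ B)) → SumListView xs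
sumListView [] = lefts []
sumListView (inj₁ a ∷ xs) with sumListView xs
... | lefts as        = lefts (a ∷ as)
... | rights []       = lefts (a ∷ [])
... | rights (_ ∷ _)  = mixed (here refl) (there (here refl))
... | mixed a∈ b∈     = mixed (there a∈) (there b∈)
sumListView (inj₂ b ∷ xs) with sumListView xs
... | lefts []        = rights (b ∷ [])
... | lefts (_ ∷ _)   = mixed (there (here refl)) (here refl)
... | rights bs       = rights (b ∷ bs)
... | mixed a∈ b∈     = mixed (there a∈) (there b∈)

module _ {n : ℕ} (B : Subset n → Bool) {A₁ A₂ : Set} (s₁ : A₁ → Subset n) (s₂ : A₂ → Subset n)
         (disjoint : ∀ a b → Disjoint (s₁ a) (s₂ b))
         (uncovered : ∀ a b {U} → T (B U) → s₁ a ⊆ U → s₂ b ⊆ U → ⊥) where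

  NestedConds-⊎ : ∀ F → NestedConds B (A₁ ⊎ A₂) [ s₁ , s₂ ] F ⇔
                        (NestedConds B A₁ s₁ (F ∘ inj₁) × NestedConds B A₂ s₂ (F ∘ inj₂))
  NestedConds-⊎ F = mk⇔
    (λ c → NestedConds-pullback B inj₁ (λ _ → refl) (λ _ → refl) c ,
           NestedConds-pullback B inj₂ (λ _ → refl) (λ _ → refl) c)
    combine
    where
    combine : NestedConds B A₁ s₁ (F ∘ inj₁) × NestedConds B A₂ s₂ (F ∘ inj₂) →
              NestedConds B (A₁ ⊎ A₂) [ s₁ , s₂ ] F
    combine ((nested₁ , unions₁) , (nested₂ , unions₂)) = nested , unions
      where
      nested : ∀ u v → T (F u) → T (F v) → NestedOrDisjoint ([ s₁ , s₂ ] u) ([ s₁ , s₂ ] v)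
      nested (inj₁ a) (inj₁ a') = nested₁ a a'
      nested (inj₁ a) (inj₂ b)  _ _ = inj₂ (inj₂ (disjoint a b))
      nested (inj₂ b) (inj₁ a)  _ _ = inj₂ (inj₂ (Disjoint-sym (disjoint a b)))
      nested (inj₂ b) (inj₂ b') = nested₂ b b'

      unions : ∀ us → All (T ∘ F) us →
               AllPairs (λ u v → Disjoint ([ s₁ , s₂ ] u) ([ s₁ , s₂ ] v)) us →
               2 ≤ length us → B (⋃ (map [ s₁ , s₂ ] us)) ≡ false
      unions us sel disj len with sumListView us
      ... | lefts as = subst (λ X → B (⋃ X) ≡ false) (map-∘ as)
        (unions₁ as (AllP.map⁻ sel) (AllPairsP.map⁻ disj) (subst (2 ≤_) (length-map inj₁ as) len))
      ... | rights bs = subst (λ X → B (⋃ X) ≡ false) (map-∘ bs)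
        (unions₂ bs (AllP.map⁻ sel) (AllPairsP.map⁻ disj) (subst (2 ≤_) (length-map inj₂ bs) len))
      ... | mixed a∈ b∈ = ¬T⇒≡false (λ bU →
        uncovered _ _ bU (∈⇒⊆-⋃-map [ s₁ , s₂ ] a∈) (∈⇒⊆-⋃-map [ s₁ , s₂ ] b∈))

Avoids : ∀ {n} {A X : Set} → (A → Subset n) → (X → Fin n) → (A → Bool) → (X → Bool) → Set
Avoids s p G H = ∀ a x → T (G a) → T (H x) → p x ∉ₛ s a

module _ {n : ℕ} {A A' X X' : Set} {s : A → Subset n} {s' : A' → Subset n}
         {p : X → Fin n} {p' : X' → Fin n} {G : A → Bool} {G' : A' → Bool}
         {H : X → Bool} {H' : X' → Bool} (f : A → A') (g : X → X')
         (label : ∀ a → s' (f a) ≡ s a) (point : ∀ x → p' (g x) ≡ p x)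
         (selectˢ : ∀ a → G' (f a) ≡ G a) (selectᵖ : ∀ x → H' (g x) ≡ H x) where

  Avoids-pullback : Avoids s' p' G' H' → Avoids s p G H
  Avoids-pullback avoids a x ga hx =
    avoids (f a) (g x) (subst T (sym (selectˢ a)) ga) (subst T (sym (selectᵖ x)) hx)
    ∘ subst₂ _∈ₛ_ (sym (point x)) (sym (label a))

Avoids-↔ : ∀ {n} {A A' X X' : Set} {s : A → Subset n} {s' : A' → Subset n}
  {p : X → Fin n} {p' : X' → Fin n} (e : A ↔ A') (d : X ↔ X') →
  (∀ a' → s (Inverse.from e a') ≡ s' a') → (∀ x' → p (Inverse.from d x') ≡ p' x') →
  ∀ G H → Avoids s p (G ∘ Inverse.to e) (H ∘ Inverse.to d) ⇔ Avoids s' p' G H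
Avoids-↔ {s = s} {p = p} e d label point G H = mk⇔
  (Avoids-pullback (Inverse.from e) (Inverse.from d) label point
     (λ a' → cong G (Inverse.strictlyInverseˡ e a')) (λ x' → cong H (Inverse.strictlyInverseˡ d x')))
  (Avoids-pullback (Inverse.to e) (Inverse.to d)
     (λ a → trans (sym (label (Inverse.to e a))) (cong s (Inverse.strictlyInverseʳ e a)))
     (λ x → trans (sym (point (Inverse.to d x))) (cong p (Inverse.strictlyInverseʳ d x)))
     (λ _ → refl) (λ _ → refl))

Avoids-⊎ : ∀ {n} {A₁ A₂ X₁ X₂ : Set} (s₁ : A₁ → Subset n) (s₂ : A₂ → Subset n)
  (p₁ : X₁ → Fin n) (p₂ : X₂ → Fin n) →
  (∀ a x → p₂ x ∉ₛ s₁ a) → (∀ b x → p₁ x ∉ₛ s₂ b) →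
  ∀ G H → Avoids [ s₁ , s₂ ] [ p₁ , p₂ ] G H ⇔
          (Avoids s₁ p₁ (G ∘ inj₁) (H ∘ inj₁) × Avoids s₂ p₂ (G ∘ inj₂) (H ∘ inj₂))
Avoids-⊎ s₁ s₂ p₁ p₂ avoid₁₂ avoid₂₁ G H = mk⇔
  (λ avoids → (λ a x → avoids (inj₁ a) (inj₁ x)) , (λ b x → avoids (inj₂ b) (inj₂ x)))
  (λ { (avoids₁ , _) (inj₁ a) (inj₁ x) → avoids₁ a x
     ; _             (inj₁ a) (inj₂ x) _ _ → avoid₁₂ a x
     ; _             (inj₂ b) (inj₁ x) _ _ → avoid₂₁ b x
     ; (_ , avoids₂) (inj₂ b) (inj₂ x) → avoids₂ b x })

≅-trans : ∀ {K L M} → K ≅ L → L ≅ M → K ≅ M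
≅-trans φ ψ = record
  { vmap    = vmap ψ ↔-∘ vmap φ
  ; faceIff = λ F → faceIff ψ F ⇔-∘ faceIff φ (F ∘ Inverse.to (vmap ψ)) }
  where open _≅_

⋆-cong : ∀ {K K' L L'} → K ≅ K' → L ≅ L' → (K ⋆ L) ≅ (K' ⋆ L')
⋆-cong φ ψ = record
  { vmap    = vmap φ ⊎-↔ vmap ψ
  ; faceIff = λ F → faceIff φ (F ∘ inj₁) ×-⇔ faceIff ψ (F ∘ inj₂) }
  where open _≅_

-- The complexes of Defs with the vertex predicate P independent of the
-- building set B governing the faces: nestedComplex G B is
-- nestedComplexOn B (λ I → B I ∧ not (isMax B I)) and extNestedComplex G B is
-- extNestedComplexOn B B (lookup G).
nestedComplexOn : ∀ {n} → (B P : Subset n → Bool) → SimplicialComplex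
nestedComplexOn {n} B P = record { V = Σ (Subset n) (T ∘ P) ; Face = NestedConds B _ proj₁ }

extNestedComplexOn : ∀ {n} → (B P : Subset n → Bool) → (Fin n → Bool) → SimplicialComplex
extNestedComplexOn {n} B P Q = record
  { V    = Σ (Subset n) (T ∘ P) ⊎ Σ (Fin n) (T ∘ Q)
  ; Face = λ F → NestedConds B _ proj₁ (F ∘ inj₁) × Avoids proj₁ proj₁ (F ∘ inj₁) (F ∘ inj₂) }

⊎-interchange : ∀ {A₁ A₂ X₁ X₂ : Set} → ((A₁ ⊎ A₂) ⊎ (X₁ ⊎ X₂)) ↔ ((A₁ ⊎ X₁) ⊎ (A₂ ⊎ X₂))
⊎-interchange = mk↔ₛ′ interchange interchange inverse inverse
  where
  interchange : ∀ {A₁ A₂ X₁ X₂ : Set} → (A₁ ⊎ A₂) ⊎ (X₁ ⊎ X₂) → (A₁ ⊎ X₁) ⊎ (A₂ ⊎ X₂)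
  interchange = [ Sum.map inj₁ inj₁ , Sum.map inj₂ inj₂ ]
  inverse : ∀ {A₁ A₂ X₁ X₂ : Set} (y : (A₁ ⊎ X₁) ⊎ (A₂ ⊎ X₂)) → interchange (interchange y) ≡ y
  inverse (inj₁ (inj₁ _)) = refl
  inverse (inj₁ (inj₂ _)) = refl
  inverse (inj₂ (inj₁ _)) = refl
  inverse (inj₂ (inj₂ _)) = refl

×-interchange : ∀ {A B C D : Set} → ((A × B) × (C × D)) ⇔ ((A × C) × (B × D))
×-interchange = mk⇔ (λ ((a , b) , (c , d)) → (a , c) , (b , d))
                    (λ ((a , c) , (b , d)) → (a , b) , (c , d))

module _ {n : ℕ} (B : Subset n → Bool) where

  nestedComplexOn-false : nestedComplexOn B (λ _ → false) ≅ unitComplex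
  nestedComplexOn-false = record
    { vmap    = mk↔ₛ′ (λ { (_ , ()) }) (λ ()) (λ ()) (λ { (_ , ()) })
    ; faceIff = λ _ → mk⇔ _ (λ _ → (λ { (_ , ()) }) , λ { [] _ _ () ; ((_ , ()) ∷ _) _ _ _ }) }

  extNestedComplexOn-false : extNestedComplexOn B (λ _ → false) (λ _ → false) ≅ unitComplex
  extNestedComplexOn-false = record
    { vmap    = mk↔ₛ′ (λ { (inj₁ (_ , ())) ; (inj₂ (_ , ())) }) (λ ()) (λ ())
                      (λ { (inj₁ (_ , ())) ; (inj₂ (_ , ())) })
    ; faceIff = λ _ → mk⇔ _ (λ _ → ((λ { (_ , ()) }) , λ { [] _ _ () ; ((_ , ()) ∷ _) _ _ _ }) ,
                                   λ { (_ , ()) }) }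

  nestedComplexOn-cong : ∀ {P P'} → (∀ I → T (P I) ⇔ T (P' I)) →
                         nestedComplexOn B P ≅ nestedComplexOn B P'
  nestedComplexOn-cong P⇔P' = record
    { vmap    = Σ-T-↔ P⇔P'
    ; faceIff = NestedConds-↔ B (Σ-T-↔ P⇔P') (λ _ → refl) }

  extNestedComplexOn-cong : ∀ {P P' Q Q'} → (∀ I → T (P I) ⇔ T (P' I)) → (∀ i → T (Q i) ⇔ T (Q' i)) →
                            extNestedComplexOn B P Q ≅ extNestedComplexOn B P' Q'
  extNestedComplexOn-cong P⇔P' Q⇔Q' = record
    { vmap    = Σ-T-↔ P⇔P' ⊎-↔ Σ-T-↔ Q⇔Q'
    ; faceIff = λ F → NestedConds-↔ B (Σ-T-↔ P⇔P') (λ _ → refl) (F ∘ inj₁)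
                      ×-⇔ Avoids-↔ (Σ-T-↔ P⇔P') (Σ-T-↔ Q⇔Q') (λ _ → refl) (λ _ → refl)
                                   (F ∘ inj₁) (F ∘ inj₂) }

  module _ {M : Subset n} {P : Subset n → Bool} (P⊆M : ∀ {I} → T (P I) → I ⊆ M) where

    nestedComplexOn-restrict : nestedComplexOn B P ≅ nestedComplexOn (restrict B M) P
    nestedComplexOn-restrict = record
      { vmap    = ↔-id _
      ; faceIff = NestedConds-restrict B M proj₁ (P⊆M ∘ proj₂) }

    extNestedComplexOn-restrict : ∀ {Q} →
                                  extNestedComplexOn B P Q ≅ extNestedComplexOn (restrict B M) P Q
    extNestedComplexOn-restrict = record
      { vmap    = ↔-id _
      ; faceIff = λ F → NestedConds-restrict B M proj₁ (P⊆M ∘ proj₂) (F ∘ inj₁) ×-⇔ ⇔-id _ }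

module _ {n : ℕ} (B : Subset n → Bool) (M : Subset n)
         (absorbs : ∀ {U} → T (B U) → Nonempty (U ∩ M) → U ⊆ M)
         {P₁ P₂ : Subset n → Bool}
         (inside : ∀ {I} → T (P₁ I) → Nonempty I × I ⊆ M)
         (outside : ∀ {I} → T (P₂ I) → Nonempty I × Disjoint I M) where

  private
    exclusive : ∀ I → T (P₁ I) → T (P₂ I) → ⊥
    exclusive I p₁ p₂ = let x , x∈I = proj₁ (inside p₁) in
      Disjoint⇒∉ (proj₂ (outside p₂)) x∈I (proj₂ (inside p₁) x∈I)

    disjoint : ∀ (a : Σ (Subset n) (T ∘ P₁)) (b : Σ (Subset n) (T ∘ P₂)) →
               Disjoint (proj₁ a) (proj₁ b)
    disjoint (I , p₁) (J , p₂) (x , x∈I∩J) = let x∈I , x∈J = x∈p∩q⁻ I J x∈I∩J in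
      Disjoint⇒∉ (proj₂ (outside p₂)) x∈J (proj₂ (inside p₁) x∈I)

    -- U meets M inside the P₁-set, so U ⊆ M, which the nonempty P₂-set forbids.
    uncovered : ∀ (a : Σ (Subset n) (T ∘ P₁)) (b : Σ (Subset n) (T ∘ P₂)) {U} →
                T (B U) → proj₁ a ⊆ U → proj₁ b ⊆ U → ⊥
    uncovered (I , p₁) (J , p₂) bU I⊆U J⊆U =
      let x , x∈I = proj₁ (inside p₁)
          U⊆M = absorbs bU (x , x∈p∩q⁺ (I⊆U x∈I , proj₂ (inside p₁) x∈I))
          y , y∈J = proj₁ (outside p₂)
      in Disjoint⇒∉ (proj₂ (outside p₂)) y∈J (U⊆M (J⊆U y∈J))

    splitLabels : ∀ w → proj₁ (Inverse.from (Σ-T-∨-↔ {P = P₁} {P₂} exclusive) w) ≡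
                        [ proj₁ , proj₁ ] w
    splitLabels (inj₁ _) = refl
    splitLabels (inj₂ _) = refl

  nestedComplexOn-∨ : nestedComplexOn B (λ I → P₁ I ∨ P₂ I) ≅
                      (nestedComplexOn B P₁ ⋆ nestedComplexOn B P₂)
  nestedComplexOn-∨ = record
    { vmap    = Σ-T-∨-↔ exclusive
    ; faceIff = λ F → NestedConds-⊎ B proj₁ proj₁ disjoint uncovered F
                      ⇔-∘ NestedConds-↔ B (Σ-T-∨-↔ exclusive) splitLabels F }

  module _ {Q₁ Q₂ : Fin n → Bool} (pointInside : ∀ {i} → T (Q₁ i) → i ∈ₛ M)
           (pointOutside : ∀ {i} → T (Q₂ i) → i ∉ₛ M) where

    private
      exclusiveᵖ : ∀ i → T (Q₁ i) → T (Q₂ i) → ⊥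
      exclusiveᵖ i q₁ q₂ = pointOutside q₂ (pointInside q₁)

      avoids₁₂ : ∀ (a : Σ (Subset n) (T ∘ P₁)) (x : Σ (Fin n) (T ∘ Q₂)) → proj₁ x ∉ₛ proj₁ a
      avoids₁₂ (I , p₁) (i , q₂) i∈I = pointOutside q₂ (proj₂ (inside p₁) i∈I)

      avoids₂₁ : ∀ (b : Σ (Subset n) (T ∘ P₂)) (x : Σ (Fin n) (T ∘ Q₁)) → proj₁ x ∉ₛ proj₁ b
      avoids₂₁ (I , p₂) (i , q₁) i∈I = Disjoint⇒∉ (proj₂ (outside p₂)) i∈I (pointInside q₁)

      splitPoints : ∀ x → proj₁ (Inverse.from (Σ-T-∨-↔ {P = Q₁} {Q₂} exclusiveᵖ) x) ≡
                          [ proj₁ , proj₁ ] x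
      splitPoints (inj₁ _) = refl
      splitPoints (inj₂ _) = refl

    extNestedComplexOn-∨ : extNestedComplexOn B (λ I → P₁ I ∨ P₂ I) (λ i → Q₁ i ∨ Q₂ i) ≅
                           (extNestedComplexOn B P₁ Q₁ ⋆ extNestedComplexOn B P₂ Q₂)
    extNestedComplexOn-∨ = record
      { vmap    = ⊎-interchange ↔-∘ (Σ-T-∨-↔ exclusive ⊎-↔ Σ-T-∨-↔ exclusiveᵖ)
      ; faceIff = λ F → let G = F ∘ Inverse.to ⊎-interchange in
          ×-interchange
          ⇔-∘ ((NestedConds-⊎ B proj₁ proj₁ disjoint uncovered (G ∘ inj₁)
                ×-⇔ Avoids-⊎ proj₁ proj₁ proj₁ proj₁ avoids₁₂ avoids₂₁ (G ∘ inj₁) (G ∘ inj₂))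
               ⇔-∘ (NestedConds-↔ B (Σ-T-∨-↔ exclusive) splitLabels (G ∘ inj₁)
                    ×-⇔ Avoids-↔ (Σ-T-∨-↔ exclusive) (Σ-T-∨-↔ exclusiveᵖ) splitLabels
                          splitPoints (G ∘ inj₁) (G ∘ inj₂))) }

-- Splitting along the maximal elements

module _ {n : ℕ} {B : Subset n → Bool} (bs : IsBuildingSet ⊤ B) where
  open IsBuildingSet bs

  module _ {M : Subset n} {Ms : List (Subset n)} (M∉Ms : All (M ≢_) Ms)
           (maxM : T (isMax B M)) (maxMs : All (T ∘ isMax B) Ms) where

    isMax-disjoint-∈ : ∀ {M'} → M' ∈ Ms → Disjoint M' M
    isMax-disjoint-∈ M'∈Ms =
      isMax-disjoint bs (All.lookup maxMs M'∈Ms) maxM (All.lookup M∉Ms M'∈Ms ∘ sym)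

    pointOutside-any : ∀ {i} → T (any (λ M' → lookup M' i) Ms) → i ∉ₛ M
    pointOutside-any {i} t = let M' , M'∈Ms , i∈M' = find (any⁻ _ Ms t) in
      Disjoint⇒∉ (isMax-disjoint-∈ M'∈Ms) (to (T-lookup⇔∈ M' i) i∈M')

  module _ (P : Subset n → Subset n → Bool) (P-sound : ∀ {M I} → T (P M I) → T (B I) × I ⊆ M) where

    inside-P : ∀ {M I} → T (P M I) → Nonempty I × I ⊆ M
    inside-P p = let bI , I⊆M = P-sound p in nonempty _ bI , I⊆M

    outside-any : ∀ {M Ms} → All (M ≢_) Ms → T (isMax B M) → All (T ∘ isMax B) Ms →
                  ∀ {I} → T (any (λ M' → P M' I) Ms) → Nonempty I × Disjoint I M
    outside-any {Ms = Ms} M∉Ms maxM maxMs t =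
      let _ , M'∈Ms , p = find (any⁻ _ Ms t) ; bI , I⊆M' = P-sound p in
      nonempty _ bI , Disjoint-⊆ˡ I⊆M' (isMax-disjoint-∈ M∉Ms maxM maxMs M'∈Ms)

    nestedComplexOn-any : ∀ Ms → Unique Ms → All (T ∘ isMax B) Ms →
      nestedComplexOn B (λ I → any (λ M → P M I) Ms) ≅
      joinAll (map (λ M → nestedComplexOn (restrict B M) (P M)) Ms)
    nestedComplexOn-any []       _                 _             = nestedComplexOn-false B
    nestedComplexOn-any (M ∷ Ms) (M∉Ms ∷ uniqMs) (maxM ∷ maxMs) = ≅-trans
      (nestedComplexOn-∨ B M (isMax-absorbs bs maxM) inside-P (outside-any M∉Ms maxM maxMs))
      (⋆-cong (nestedComplexOn-restrict B (proj₂ ∘ P-sound)) (nestedComplexOn-any Ms uniqMs maxMs))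

    extNestedComplexOn-any : ∀ Ms → Unique Ms → All (T ∘ isMax B) Ms →
      extNestedComplexOn B (λ I → any (λ M → P M I) Ms) (λ i → any (λ M → lookup M i) Ms) ≅
      joinAll (map (λ M → extNestedComplexOn (restrict B M) (P M) (lookup M)) Ms)
    extNestedComplexOn-any []       _                 _             = extNestedComplexOn-false B
    extNestedComplexOn-any (M ∷ Ms) (M∉Ms ∷ uniqMs) (maxM ∷ maxMs) = ≅-trans
      (extNestedComplexOn-∨ B M (isMax-absorbs bs maxM) inside-P (outside-any M∉Ms maxM maxMs)
        (to (T-lookup⇔∈ M _)) (pointOutside-any M∉Ms maxM maxMs))
      (⋆-cong (extNestedComplexOn-restrict B (proj₂ ∘ P-sound))
              (extNestedComplexOn-any Ms uniqMs maxMs))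

  module _ {Ms : List (Subset n)} (Ms⇔max : ∀ M → (M ∈ Ms) ⇔ T (isMax B M)) where

    component : ∀ {I} → T (B I) → ∃ λ M → M ∈ Ms × I ⊆ M
    component bI = let M , maxM , I⊆M = isMax-above bs bI in M , from (Ms⇔max M) maxM , I⊆M

    T-any-restrict : ∀ I → T (B I) ⇔ T (any (λ M → restrict B M I) Ms)
    T-any-restrict I = mk⇔
      (λ bI → let M , M∈Ms , I⊆M = component bI in
        any⁺ _ (lose M∈Ms (from (T-restrict B) (bI , I⊆M))))
      (λ t → let _ , _ , rI = find (any⁻ _ Ms t) in proj₁ (to (T-restrict B) rI))

    T-any-restrict-nonMax : ∀ I → T (B I ∧ not (isMax B I)) ⇔
                                  T (any (λ M → restrict B M I ∧ not (isMax (restrict B M) I)) Ms)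
    T-any-restrict-nonMax I = mk⇔
      (λ t → let bI , nonMax = to (T-∧ {B I}) t ; M , M∈Ms , I⊆M = component bI in
        any⁺ _ (lose M∈Ms (from T-∧ (from (T-restrict B) (bI , I⊆M) ,
          to (T-not-cong (isMax-restrict bs (to (Ms⇔max M) M∈Ms) I⊆M)) nonMax))))
      (λ t → let M , M∈Ms , r = find (any⁻ _ Ms t) ; rI , nonMax = to (T-∧ {restrict B M I}) r
                 bI , I⊆M = to (T-restrict B) rI in
        from T-∧ (bI , from (T-not-cong (isMax-restrict bs (to (Ms⇔max M) M∈Ms) I⊆M)) nonMax))

    T-any-lookup : ∀ i → T (lookup ⊤ i) ⇔ T (any (λ M → lookup M i) Ms)
    T-any-lookup i = mk⇔
      (λ _ → let M , M∈Ms , ⁅i⁆⊆M = component (singletons i ∈⊤) in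
        any⁺ _ (lose M∈Ms (from (T-lookup⇔∈ M i) (⁅i⁆⊆M (x∈⁅x⁆ i)))))
      (λ _ → from (T-lookup⇔∈ ⊤ i) ∈⊤)

lemma2p18 : (n : ℕ) (B : Subset n → Bool) → IsBuildingSet Data.Fin.Subset.⊤ B
    → (Ms : List (Subset n)) → Unique Ms → (∀ M → (M ∈ Ms) ⇔ T (isMax B M))
    → (nestedComplex Data.Fin.Subset.⊤ B ≅ joinAll (map (λ M → nestedComplex M (restrict B M)) Ms))
    × (extNestedComplex Data.Fin.Subset.⊤ B ≅ joinAll (map (λ M → extNestedComplex M (restrict B M)) Ms))
lemma2p18 n B bs Ms uniqMs Ms⇔max =
  ≅-trans (nestedComplexOn-cong B (T-any-restrict-nonMax bs Ms⇔max))
          (nestedComplexOn-any bs nonMaxIn nonMaxIn-sound Ms uniqMs maxMs) ,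
  ≅-trans (extNestedComplexOn-cong B (T-any-restrict bs Ms⇔max) (T-any-lookup bs Ms⇔max))
          (extNestedComplexOn-any bs (restrict B) (to (T-restrict B)) Ms uniqMs maxMs)
  where
  maxMs : All (T ∘ isMax B) Ms
  maxMs = All.tabulate (to (Ms⇔max _))

  nonMaxIn : Subset n → Subset n → Bool
  nonMaxIn M I = restrict B M I ∧ not (isMax (restrict B M) I)

  nonMaxIn-sound : ∀ {M I} → T (nonMaxIn M I) → T (B I) × I ⊆ M
  nonMaxIn-sound {M} {I} = to (T-restrict B) ∘ proj₁ ∘ to (T-∧ {restrict B M I})
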